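{- Let $G=(V,E)$ be a finite simple undirected graph, let $k \ge 0$ be an integer, and let $lb$ be an integer with $lb \le \eta(G,k)$. If there exists a vertex $u \in V$ such that $\omega(G[N(u)]) \le lb - 2$, then $\eta(G,k) = \eta(G[V \setminus \{u\}], k)$.
   Context: For a graph $H=(W,D)$, $\omega(H)$ denotes its clique number (size of a largest clique; $0$ for the empty graph). $N(u)$ is the set of neighbours of $u$ in $G$, and $G[S]$ the subgraph of $G$ induced by $S\subseteq V$. For a graph $H=(W,D)$ and integer $k\ge 0$, $\eta(H,k) = \min\{\omega((W, D\setminus F)) : F \subseteq D,\ |F| \le k\}$, the minimum clique number achievable by deleting at most $k$ edges. -}

module Defs where

open import Data.Bool using (Bool; true; false; _∧_; _∨_; not; if_then_else_)
open import Data.Nat using (ℕ; zero; suc; _⊔_; _⊓_)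
open import Data.Fin using (Fin; _≟_)
open import Data.Fin.Subset using (Subset; ∣_∣; _∩_; ⁅_⁆; ∁)
open import Data.Vec using (Vec; []; _∷_; lookup)
open import Data.List using (List; []; _∷_; map; foldr; filter; allFin; cartesianProduct; _++_; concatMap)
open import Data.Bool.ListAction using (any; all)
open import Data.Product using (_×_; _,_)
open import Relation.Binary.PropositionalEquality using (_≡_)
open import Relation.Nullary.Decidable using (⌊_⌋)

record Graph (n : ℕ) : Set where
  field
    adj    : Fin n → Fin n → Bool
    sym    : ∀ i j → adj i j ≡ adj j i
    irrefl : ∀ i → adj i i ≡ false
open Graph public

-- A general graph H = (W, D) whose vertex set W is a subset of Fin n and
-- whose edge relation D is a Bool-valued relation (only its restriction to
-- W matters).  Induced subgraphs and edge-deleted graphs are of this form.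
record SubGraph (n : ℕ) : Set where
  constructor ⟨_,_⟩
  field
    verts : Subset n
    edges : Fin n → Fin n → Bool
open SubGraph public

whole : ∀ {n} → Graph n → SubGraph n
whole {n} G = ⟨ allTrue n , adj G ⟩
  where
  allTrue : ∀ m → Subset m
  allTrue zero = []
  allTrue (suc m) = true ∷ allTrue m

induced : ∀ {n} → Graph n → Subset n → SubGraph n
induced G S = ⟨ S , adj G ⟩

N : ∀ {n} → Graph n → Fin n → Subset n
N {n} G u = Data.Vec.tabulate (λ v → adj G u v)
  where import Data.Vec

V∖ : ∀ {n} → Fin n → Subset n
V∖ u = ∁ ⁅ u ⁆

allSubsets : ∀ n → List (Subset n)
allSubsets zero = [] ∷ []
allSubsets (suc n) = map (true ∷_) (allSubsets n) ++ map (false ∷_) (allSubsets n)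

isClique : ∀ {n} → SubGraph n → Subset n → Bool
isClique {n} H C =
  all (λ i → not (lookup C i) ∨ lookup (verts H) i) (allFin n) ∧
  all (λ i → all (λ j → not (lookup C i ∧ lookup C j) ∨ ⌊ i ≟ j ⌋ ∨ edges H i j)
                 (allFin n)) (allFin n)

ω : ∀ {n} → SubGraph n → ℕ
ω {n} H = foldr (λ C m → ∣ C ∣ ⊔ m) 0 (filter (λ C → isClique H C Data.Bool.≟ true) (allSubsets n))
  where import Data.Bool

deleteEdges : ∀ {n} → SubGraph n → List (Fin n × Fin n) → SubGraph n
deleteEdges H F =
  ⟨ verts H , (λ i j → edges H i j ∧ not (any (λ { (a , b) → (⌊ a ≟ i ⌋ ∧ ⌊ b ≟ j ⌋) ∨ (⌊ a ≟ j ⌋ ∧ ⌊ b ≟ i ⌋) }) F)) ⟩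

listsUpTo : ∀ {n} → ℕ → List (List (Fin n × Fin n))
listsUpTo zero = [] ∷ []
listsUpTo {n} (suc k) =
  [] ∷ concatMap (λ F → map (_∷ F) (cartesianProduct (allFin n) (allFin n))) (listsUpTo k)

-- F ranges over lists of at most k unordered pairs; pairs that are not
-- edges (or repeated pairs) are harmless, since they delete nothing extra.
η : ∀ {n} → SubGraph n → ℕ → ℕ
η H k = foldr (λ F m → ω (deleteEdges H F) ⊓ m) (ω H) (listsUpTo k)

module Submission where

-- Deleting edges never creates cliques, and G[V ∖ {u}] is a subgraph of G, so
-- η(G[V ∖ {u}], k) ≤ η(G, k).  Conversely, fix any deleted edge set F.  A clique
-- of G − F avoiding u is a clique of G[V ∖ {u}] − F, and a clique containing u
-- is u together with a clique of G[N(u)], so it has at most ω(G[N(u)]) + 1 ≤ lb − 1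
-- vertices.  Hence η(G, k) ≤ max (η(G[V ∖ {u}], k), lb − 1), and since
-- η(G, k) ≥ lb the maximum is attained by its first argument.

open import Defs hiding (sym)
open import Data.Bool using (Bool; true; false; _∧_; _∨_; not) renaming (_≟_ to _≟ᵇ_)
open import Data.Bool.ListAction using (all)
open import Data.Bool.Properties using (∧-conicalˡ; ∧-conicalʳ)
open import Data.Fin using (Fin; zero; suc; _≟_)
open import Data.Fin.Subset using (Subset; _∈_; _⊆_; ∣_∣; _-_; ⁅_⁆; inside; outside)
open import Data.Fin.Subset.Properties
  using (_∈?_; p─⊥≡p; p─q⊆p; x∉p⇒x∈∁p; x≢y⇒x∉⁅y⁆)
open import Data.List using ([]; _∷_; foldr; filter; allFin; map)
open import Data.List.Membership.Propositional using () renaming (_∈_ to _∈ˡ_)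
open import Data.List.Membership.Propositional.Properties
  using (∈-allFin; ∈-map⁺; ∈-++⁺ˡ; ∈-++⁺ʳ; ∈-filter⁺; ∈-filter⁻)
open import Data.List.Relation.Unary.Any using (here; there)
open import Data.Nat using (ℕ; suc; _≤_; _<_; _+_; _⊔_; _⊓_; z≤n; s≤s)
open import Data.Nat.Properties
  using (≤-trans; ≤-antisym; ≤-reflexive; <-≤-trans; <⇒≱; n≤1+n; +-comm;
         m≤m⊔n; m≤n⇒m≤n⊔o; m≤n⇒m≤o⊔n; ⊔-lub; ⊔-sel; ⊓-mono-≤; ⊔-distribʳ-⊓)
open import Data.Product using (_×_; _,_; proj₂)
open import Data.Sum using (inj₁; inj₂)
open import Data.Vec using ([]; _∷_; lookup; here; there)
open import Data.Vec.Properties using ([]=⇒lookup; lookup⇒[]=; lookup∘tabulate)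
open import Function using (_∘_; id)
open import Relation.Binary.PropositionalEquality
  using (_≡_; _≢_; refl; sym; trans; cong; cong₂; subst)
open import Relation.Nullary using (Dec; yes; no; contradiction)
open import Relation.Nullary.Decidable using (⌊_⌋)

private
  variable
    n : ℕ

not-∨-elim : ∀ {a b} → not a ∨ b ≡ true → a ≡ true → b ≡ true
not-∨-elim b≡true refl = b≡true

not-∨-intro : ∀ {a b} → (a ≡ true → b ≡ true) → not a ∨ b ≡ true
not-∨-intro {false} _ = refl
not-∨-intro {true}  f = f refl

all-true⁻ : ∀ {A : Set} (p : A → Bool) {xs x} → all p xs ≡ true → x ∈ˡ xs → p x ≡ true
all-true⁻ p h (here refl) = ∧-conicalˡ _ _ h
all-true⁻ p h (there x∈xs) = all-true⁻ p (∧-conicalʳ _ _ h) x∈xs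

all-true⁺ : ∀ {A : Set} (p : A → Bool) xs → (∀ x → p x ≡ true) → all p xs ≡ true
all-true⁺ p [] _ = refl
all-true⁺ p (x ∷ xs) h = cong₂ _∧_ (h x) (all-true⁺ p xs h)

module _ {A : Set} (f : A → ℕ) where

  ≤-foldr-⊔ : ∀ {x xs} → x ∈ˡ xs → f x ≤ foldr (λ y m → f y ⊔ m) 0 xs
  ≤-foldr-⊔ (here refl) = m≤m⊔n _ _
  ≤-foldr-⊔ (there x∈xs) = m≤n⇒m≤o⊔n _ (≤-foldr-⊔ x∈xs)

  foldr-⊔-lub : ∀ {m} xs → (∀ {x} → x ∈ˡ xs → f x ≤ m) → foldr (λ y m → f y ⊔ m) 0 xs ≤ m
  foldr-⊔-lub [] _ = z≤n
  foldr-⊔-lub (x ∷ xs) bound = ⊔-lub (bound (here refl)) (foldr-⊔-lub xs (bound ∘ there))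

foldr-⊓-mono : ∀ {A : Set} {f g : A → ℕ} {b c} → b ≤ c → (∀ x → f x ≤ g x) → ∀ xs →
               foldr (λ x m → f x ⊓ m) b xs ≤ foldr (λ x m → g x ⊓ m) c xs
foldr-⊓-mono b≤c f≤g [] = b≤c
foldr-⊓-mono b≤c f≤g (x ∷ xs) = ⊓-mono-≤ (f≤g x) (foldr-⊓-mono b≤c f≤g xs)

foldr-⊓-⊔-distrib : ∀ {A : Set} (f : A → ℕ) b c xs →
                    foldr (λ x m → (f x ⊔ c) ⊓ m) (b ⊔ c) xs ≡ foldr (λ x m → f x ⊓ m) b xs ⊔ c
foldr-⊓-⊔-distrib f b c [] = refl
foldr-⊓-⊔-distrib f b c (x ∷ xs) =
  trans (cong ((f x ⊔ c) ⊓_) (foldr-⊓-⊔-distrib f b c xs))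
        (sym (⊔-distribʳ-⊓ c (f x) (foldr (λ x m → f x ⊓ m) b xs)))

foldr-⊓-≤-⊔ : ∀ {A : Set} {f g : A → ℕ} {b b′ c} → b ≤ b′ ⊔ c → (∀ x → f x ≤ g x ⊔ c) → ∀ xs →
              foldr (λ x m → f x ⊓ m) b xs ≤ foldr (λ x m → g x ⊓ m) b′ xs ⊔ c
foldr-⊓-≤-⊔ {g = g} {b′ = b′} {c} b≤ f≤ xs =
  ≤-trans (foldr-⊓-mono b≤ f≤ xs) (≤-reflexive (foldr-⊓-⊔-distrib g b′ c xs))

m≤n⊔o∧o<m⇒m≤n : ∀ {m n o} → m ≤ n ⊔ o → o < m → m ≤ n
m≤n⊔o∧o<m⇒m≤n {m} {n} {o} m≤n⊔o o<m with ⊔-sel n o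
... | inj₁ n⊔o≡n = subst (m ≤_) n⊔o≡n m≤n⊔o
... | inj₂ n⊔o≡o = contradiction (subst (m ≤_) n⊔o≡o m≤n⊔o) (<⇒≱ o<m)

∣p∣≤1+∣p-x∣ : ∀ (p : Subset n) x → ∣ p ∣ ≤ suc ∣ p - x ∣
∣p∣≤1+∣p-x∣ (inside  ∷ p) zero = ≤-reflexive (cong (suc ∘ ∣_∣) (sym (p─⊥≡p p)))
∣p∣≤1+∣p-x∣ (outside ∷ p) zero = subst (λ q → ∣ p ∣ ≤ suc ∣ q ∣) (sym (p─⊥≡p p)) (n≤1+n _)
∣p∣≤1+∣p-x∣ (inside  ∷ p) (suc x) = s≤s (∣p∣≤1+∣p-x∣ p x)
∣p∣≤1+∣p-x∣ (outside ∷ p) (suc x) = ∣p∣≤1+∣p-x∣ p x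

x∈p-y⇒x≢y : ∀ {p : Subset n} {x y} → x ∈ p - y → x ≢ y
x∈p-y⇒x≢y {p = _ ∷ p} {suc x} {suc y} (there x∈p-y) refl = x∈p-y⇒x≢y {p = p} x∈p-y refl

Clique : SubGraph n → Subset n → Set
Clique H C = C ⊆ verts H × (∀ {i j} → i ∈ C → j ∈ C → i ≢ j → edges H i j ≡ true)

isClique-sound : ∀ (H : SubGraph n) C → isClique H C ≡ true → Clique H C
isClique-sound H C h = inVerts , adjacent
  where
  inVerts : C ⊆ verts H
  inVerts {i} i∈C = lookup⇒[]= i (verts H)
    (not-∨-elim (all-true⁻ _ (∧-conicalˡ _ _ h) (∈-allFin i)) ([]=⇒lookup i∈C))

  adjacent : ∀ {i j} → i ∈ C → j ∈ C → i ≢ j → edges H i j ≡ true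
  adjacent {i} {j} i∈C j∈C i≢j = notEqual (i ≟ j)
    (not-∨-elim (all-true⁻ _ (all-true⁻ _ (∧-conicalʳ _ _ h) (∈-allFin i)) (∈-allFin j))
                (cong₂ _∧_ ([]=⇒lookup i∈C) ([]=⇒lookup j∈C)))
    where
    notEqual : (i≟j : Dec (i ≡ j)) → ⌊ i≟j ⌋ ∨ edges H i j ≡ true → edges H i j ≡ true
    notEqual (yes i≡j) _ = contradiction i≡j i≢j
    notEqual (no _) eᵢⱼ = eᵢⱼ

isClique-complete : ∀ (H : SubGraph n) C → Clique H C → isClique H C ≡ true
isClique-complete {n} H C (C⊆V , adjacent) =
  cong₂ _∧_ (all-true⁺ _ (allFin n) inVerts)
            (all-true⁺ _ (allFin n) λ i → all-true⁺ _ (allFin n) (adjacentᵇ i))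
  where
  inVerts : ∀ i → not (lookup C i) ∨ lookup (verts H) i ≡ true
  inVerts i = not-∨-intro λ Cᵢ → []=⇒lookup (C⊆V (lookup⇒[]= i C Cᵢ))

  adjacentᵇ : ∀ i j → not (lookup C i ∧ lookup C j) ∨ ⌊ i ≟ j ⌋ ∨ edges H i j ≡ true
  adjacentᵇ i j with i ≟ j
  ... | yes _ = not-∨-intro λ _ → refl
  ... | no i≢j = not-∨-intro λ Cᵢⱼ →
    adjacent (lookup⇒[]= i C (∧-conicalˡ _ _ Cᵢⱼ)) (lookup⇒[]= j C (∧-conicalʳ _ _ Cᵢⱼ)) i≢j

∈-allSubsets : ∀ (C : Subset n) → C ∈ˡ allSubsets n
∈-allSubsets [] = here refl
∈-allSubsets {suc n} (true  ∷ C) = ∈-++⁺ˡ (∈-map⁺ (true ∷_) (∈-allSubsets C))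
∈-allSubsets {suc n} (false ∷ C) = ∈-++⁺ʳ (map (true ∷_) (allSubsets n)) (∈-map⁺ (false ∷_) (∈-allSubsets C))

module _ (H : SubGraph n) where

  private
    isClique? = λ C → isClique H C ≟ᵇ true

  ∣C∣≤ω : ∀ {C} → Clique H C → ∣ C ∣ ≤ ω H
  ∣C∣≤ω {C} clique =
    ≤-foldr-⊔ ∣_∣ (∈-filter⁺ isClique? (∈-allSubsets C) (isClique-complete H C clique))

  ω-lub : ∀ {m} → (∀ {C} → Clique H C → ∣ C ∣ ≤ m) → ω H ≤ m
  ω-lub bound = foldr-⊔-lub ∣_∣ (filter isClique? (allSubsets n)) λ {C} C∈ →
    bound (isClique-sound H C (proj₂ (∈-filter⁻ isClique? {xs = allSubsets n} C∈)))

_⊆ᴳ_ : SubGraph n → SubGraph n → Set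
H ⊆ᴳ H′ = verts H ⊆ verts H′ × (∀ {i j} → edges H i j ≡ true → edges H′ i j ≡ true)

ω-mono : ∀ {H H′ : SubGraph n} → H ⊆ᴳ H′ → ω H ≤ ω H′
ω-mono {H = H} {H′} (V⊆V′ , E⊆E′) =
  ω-lub H λ (C⊆V , adjacent) → ∣C∣≤ω H′ ((V⊆V′ ∘ C⊆V) , λ i∈C j∈C i≢j → E⊆E′ (adjacent i∈C j∈C i≢j))

deleteEdges-mono : ∀ {H H′ : SubGraph n} F → H ⊆ᴳ H′ → deleteEdges H F ⊆ᴳ deleteEdges H′ F
deleteEdges-mono F (V⊆V′ , E⊆E′) = V⊆V′ , λ e → cong₂ _∧_ (E⊆E′ (∧-conicalˡ _ _ e)) (∧-conicalʳ _ _ e)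

η-mono : ∀ {H H′ : SubGraph n} k → H ⊆ᴳ H′ → η H k ≤ η H′ k
η-mono k H⊆H′ = foldr-⊓-mono (ω-mono H⊆H′) (λ F → ω-mono (deleteEdges-mono F H⊆H′)) (listsUpTo k)

edgeless : ∀ n → Graph n
edgeless n = record { adj = λ _ _ → false ; sym = λ _ _ → refl ; irrefl = λ _ → refl }

-- The vertex set of `whole G` does not depend on G, so any graph serves in the recursive call.
∈-whole : ∀ (G : Graph n) i → i ∈ verts (whole G)
∈-whole G zero = here
∈-whole {suc n} G (suc i) = there (∈-whole (edgeless n) i)

induced⊆ᴳwhole : ∀ (G : Graph n) S → induced G S ⊆ᴳ whole G
induced⊆ᴳwhole G S = (λ {i} _ → ∈-whole G i) , λ e → e

∈-N : ∀ (G : Graph n) {u i} → adj G u i ≡ true → i ∈ N G u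
∈-N G {u} {i} uᵢ = lookup⇒[]= i (N G u) (trans (lookup∘tabulate (adj G u) i) uᵢ)

∈-V∖ : ∀ {u i : Fin n} → i ≢ u → i ∈ V∖ u
∈-V∖ i≢u = x∉p⇒x∈∁p (x≢y⇒x∉⁅y⁆ i≢u)

ω-remove-vertex : ∀ (G : Graph n) u (H : SubGraph n) → (∀ {i j} → edges H i j ≡ true → adj G i j ≡ true) →
                  ω H ≤ ω ⟨ V∖ u , edges H ⟩ ⊔ suc (ω (induced G (N G u)))
ω-remove-vertex G u H E⊆adj = ω-lub H bound
  where
  bound : ∀ {C} → Clique H C → ∣ C ∣ ≤ ω ⟨ V∖ u , edges H ⟩ ⊔ suc (ω (induced G (N G u)))
  bound {C} (_ , adjacent) with u ∈? C
  ... | no u∉C = m≤n⇒m≤n⊔o _ (∣C∣≤ω ⟨ V∖ u , edges H ⟩ (avoidsU , adjacent))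
    where
    avoidsU : C ⊆ V∖ u
    avoidsU i∈C = ∈-V∖ λ { refl → u∉C i∈C }
  ... | yes u∈C = m≤n⇒m≤o⊔n _ (≤-trans (∣p∣≤1+∣p-x∣ C u) (s≤s (∣C∣≤ω (induced G (N G u)) (inN , adjacentᴳ))))
    where
    inC : C - u ⊆ C
    inC = p─q⊆p C ⁅ u ⁆

    inN : C - u ⊆ N G u
    inN i∈C-u = ∈-N G (E⊆adj (adjacent u∈C (inC i∈C-u) (x∈p-y⇒x≢y i∈C-u ∘ sym)))

    adjacentᴳ : ∀ {i j} → i ∈ C - u → j ∈ C - u → i ≢ j → adj G i j ≡ true
    adjacentᴳ i∈ j∈ i≢j = E⊆adj (adjacent (inC i∈) (inC j∈) i≢j)

η-remove-vertex : ∀ (G : Graph n) u (H : SubGraph n) k → (∀ {i j} → edges H i j ≡ true → adj G i j ≡ true) →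
                  η H k ≤ η ⟨ V∖ u , edges H ⟩ k ⊔ suc (ω (induced G (N G u)))
η-remove-vertex G u H k E⊆adj =
  foldr-⊓-≤-⊔ (ω-remove-vertex G u H E⊆adj)
              (λ F → ω-remove-vertex G u (deleteEdges H F) (E⊆adj ∘ ∧-conicalˡ _ _))
              (listsUpTo k)

lemma2 : ∀ {n} (G : Graph n) (k lb : ℕ) → lb ≤ η (whole G) k →
         ∀ (u : Fin n) → ω (induced G (N G u)) + 2 ≤ lb →
         η (whole G) k ≡ η (induced G (V∖ u)) k
lemma2 G k lb lb≤η u ω+2≤lb =
  ≤-antisym (m≤n⊔o∧o<m⇒m≤n (η-remove-vertex G u (whole G) k id) 1+ω<η)
            (η-mono k (induced⊆ᴳwhole G (V∖ u)))
  where
  1+ω<η : suc (ω (induced G (N G u))) < η (whole G) k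
  1+ω<η = <-≤-trans (≤-trans (≤-reflexive (+-comm 2 _)) ω+2≤lb) lb≤η
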